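{- For every positive integer $j$, a graph $G$ is a $(1,j)$ phylogeny graph if and only if $G$ is a forest with maximum degree at most $j+1$.
   Context: All digraphs are finite and simple. For positive integers $i,j$, an $(i,j)$ digraph is an acyclic digraph in which every vertex has indegree at most $i$ and outdegree at most $j$. For an acyclic digraph $D$: the underlying graph $U(D)$ is the simple graph on $V(D)$ with edge set $\{uv : (u,v)\in A(D)\text{ or }(v,u)\in A(D)\}$; the competition graph $C(D)$ is the simple graph on $V(D)$ with edge set $\{uv : u\neq v,\ (u,w),(v,w)\in A(D)\text{ for some } w\}$; the phylogeny graph $P(D)$ is the graph on $V(D)$ with edge set $E(U(D))\cup E(C(D))$. A graph $G$ is an $(i,j)$ phylogeny graph if there is an $(i,j)$ digraph $D$ with $P(D)$ isomorphic to $G$. -}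

module Defs where

open import Data.Nat using (ℕ; zero; suc; _≤_; _+_)
open import Data.Bool using (Bool; true; false; _∧_; _∨_; not; T; if_then_else_)
open import Data.Fin using (Fin; zero; suc; inject₁; fromℕ; _≟_)
open import Data.List using (List; map; allFin)
open import Data.Nat.ListAction using (sum)
open import Data.Bool.ListAction using (any)
open import Data.Product using (Σ; _×_; ∃)
open import Relation.Nullary using (¬_)
open import Relation.Nullary.Decidable using (⌊_⌋)
open import Relation.Binary.PropositionalEquality using (_≡_; _≢_)
open import Function.Definitions using (Injective)
open import Data.Fin.Permutation using (Permutation′; _⟨$⟩ʳ_)

count : {n : ℕ} → (Fin n → Bool) → ℕ
count {n} p = sum (map (λ x → if p x then 1 else 0) (allFin n))

record Graph (n : ℕ) : Set where
  field
    adj   : Fin n → Fin n → Bool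
    irrefl : ∀ u → adj u u ≡ false
    symm   : ∀ u v → adj u v ≡ adj v u

open Graph public

degree : {n : ℕ} → Graph n → Fin n → ℕ
degree G v = count (λ u → adj G v u)

MaxDegreeAtMost : {n : ℕ} → Graph n → ℕ → Set
MaxDegreeAtMost G d = ∀ v → degree G v ≤ d

-- a cycle: distinct vertices v₀, …, v_{k+2} (length k+3 ≥ 3) with
-- v_i v_{i+1} edges and v_{k+2} v₀ an edge
record Cycle {n : ℕ} (G : Graph n) : Set where
  field
    k      : ℕ
    vs     : Fin (suc (suc (suc k))) → Fin n
    inj    : Injective _≡_ _≡_ vs
    steps  : ∀ (i : Fin (suc (suc k))) → T (adj G (vs (inject₁ i)) (vs (suc i)))
    close  : T (adj G (vs (fromℕ (suc (suc k)))) (vs zero))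

IsForest : {n : ℕ} → Graph n → Set
IsForest G = ¬ Cycle G

record Digraph (n : ℕ) : Set where
  field
    arc     : Fin n → Fin n → Bool
    loopless : ∀ u → arc u u ≡ false

open Digraph public

data Walk⁺ {n : ℕ} (D : Digraph n) : Fin n → Fin n → Set where
  one  : ∀ {u v} → T (arc D u v) → Walk⁺ D u v
  step : ∀ {u v w} → T (arc D u v) → Walk⁺ D v w → Walk⁺ D u w

Acyclic : {n : ℕ} → Digraph n → Set
Acyclic D = ∀ v → ¬ Walk⁺ D v v

indegree : {n : ℕ} → Digraph n → Fin n → ℕ
indegree D v = count (λ u → arc D u v)

outdegree : {n : ℕ} → Digraph n → Fin n → ℕ
outdegree D v = count (λ w → arc D v w)

IsIJDigraph : {n : ℕ} → ℕ → ℕ → Digraph n → Set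
IsIJDigraph i j D =
  Acyclic D × (∀ v → indegree D v ≤ i) × (∀ v → outdegree D v ≤ j)

neq : {n : ℕ} → Fin n → Fin n → Bool
neq u v = not ⌊ u ≟ v ⌋

underlyingAdj : {n : ℕ} → Digraph n → Fin n → Fin n → Bool
underlyingAdj D u v = arc D u v ∨ arc D v u

competitionAdj : {n : ℕ} → Digraph n → Fin n → Fin n → Bool
competitionAdj {n} D u v =
  neq u v ∧ any (λ w → arc D u w ∧ arc D v w) (allFin n)

phylogenyAdj : {n : ℕ} → Digraph n → Fin n → Fin n → Bool
phylogenyAdj D u v = underlyingAdj D u v ∨ competitionAdj D u v

-- G is an (i,j) phylogeny graph: some (i,j) digraph D has P(D) ≅ G.
-- (P(D) is simple, so G being isomorphic to it is expressed by
--  adjacency preservation under a permutation.)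
IsPhylogenyGraph : {n : ℕ} → ℕ → ℕ → Graph n → Set
IsPhylogenyGraph {n} i j G =
  ∃ λ (D : Digraph n) → IsIJDigraph i j D ×
    (Σ (Permutation′ n) λ π → ∀ u v → adj G (π ⟨$⟩ʳ u) (π ⟨$⟩ʳ v) ≡ phylogenyAdj D u v)

module Submission where

-- In a digraph with all indegrees ≤ 1 no two vertices have a common out-neighbour, so the
-- competition graph is edgeless and P(D) = U(D).  Hence the theorem says: G is, up to
-- relabelling, the underlying graph of an acyclic digraph with indegrees ≤ 1 and
-- outdegrees ≤ j exactly when G is a forest of maximum degree ≤ j + 1.
--
-- "Only if": the degree of v in U(D) is outdeg v + indeg v ≤ j + 1, and a cycle of U(D)
-- would have to be a directed cycle, since two of its arcs pointing at a common vertex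
-- would give that vertex indegree 2.  Both properties are invariant under relabelling.
--
-- "If": by induction on the number of vertices.  A nonempty forest has a leaf x (a graph of
-- minimum degree ≥ 2 contains a cycle); orient G − x and attach x as a source when its
-- neighbour has indegree 0, and as a sink otherwise.

open import Defs
import Data.Nat.Properties
open import Algebra.Properties.CommutativeSemigroup Data.Nat.Properties.+-commutativeSemigroup
  using (x∙yz≈y∙xz)
open import Data.Bool using (Bool; true; false; _∧_; _∨_; T; if_then_else_)
open import Data.Bool.Properties using (∨-comm; ∨-identityʳ; T-≡; T-∨; T-∧)
open import Data.Empty using (⊥; ⊥-elim)
open import Data.Fin using (Fin; zero; suc; _≟_; punchIn; punchOut; toℕ; fromℕ; fromℕ<; inject₁)
open import Data.Fin.Permutation using (Permutation′; _⟨$⟩ʳ_; _⟨$⟩ˡ_; inverseˡ; inverseʳ)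
import Data.Fin.Permutation as Permutation
open import Data.Fin.Properties
  using ( any?; pigeonhole; suc-injective; toℕ-injective; toℕ<n; toℕ-inject₁; toℕ-fromℕ
        ; toℕ-fromℕ<; fromℕ<-toℕ; punchInᵢ≢i; punchIn-injective; punchIn-punchOut
        ; punchOut-cong; punchOut-punchIn; punchOut-injective )
open import Data.List using (allFin)
open import Data.List.Properties using (map-tabulate)
open import Data.List.Relation.Unary.Any using (satisfied)
open import Data.List.Relation.Unary.Any.Properties using (any⁻)
open import Data.Maybe using (Maybe; just; nothing)
open import Data.Nat using (ℕ; zero; suc; _≤_; _<_; _+_; z≤n; s≤s) renaming (_≟_ to _≟ℕ_)
open import Data.Nat.Induction using (<-rec)
open import Data.Nat.ListAction using (sum)
open import Data.Nat.Properties
  using ( _<?_; _≤?_; <-cmp; <-irrefl; <⇒≤; <⇒≢; ≤-antisym; ≤-pred; ≤-refl; ≤-trans; ≰⇒>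
        ; ≤∧≢⇒<; m≤n⇒m<n∨m≡n; m≤n⇒∃[o]m+o≡n; m≤n+m; n<1+n; n≤1+n; n≢0⇒n>0
        ; +-comm; +-suc; +-identityʳ; +-cancelʳ-≡; +-mono-≤; +-monoˡ-≤; +-monoʳ-≤
        ; module ≤-Reasoning )
open import Data.Product using (∃; _,_; _×_; proj₁; proj₂)
open import Data.Sum using (_⊎_; inj₁; inj₂)
open import Data.Unit using (tt)
open import Function using (_∘_; id; case_of_)
open import Function.Bundles using (Equivalence; _⇔_; mk⇔)
open import Function.Definitions using (Injective)
open import Relation.Binary.Definitions using (tri<; tri≈; tri>)
open import Relation.Binary.PropositionalEquality
  using (_≡_; _≢_; refl; sym; trans; cong; cong₂; subst; module ≡-Reasoning)
open import Relation.Nullary using (¬_; Dec; yes; no)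
open import Relation.Nullary.Decidable using (T?; _×-dec_)

[_] : Bool → ℕ
[ b ] = if b then 1 else 0

count-suc : ∀ {n} (p : Fin (suc n) → Bool) → count p ≡ [ p zero ] + count (p ∘ suc)
count-suc p = cong (λ xs → [ p zero ] + sum xs)
  (trans (map-tabulate suc (λ x → [ p x ])) (sym (map-tabulate id (λ x → [ p (suc x) ]))))

count-ext : ∀ {n} {p q : Fin n → Bool} → (∀ i → p i ≡ q i) → count p ≡ count q
count-ext {zero} p≡q = refl
count-ext {suc n} {p} {q} p≡q = begin
  count p                       ≡⟨ count-suc p ⟩
  [ p zero ] + count (p ∘ suc)  ≡⟨ cong₂ _+_ (cong [_] (p≡q zero)) (count-ext (p≡q ∘ suc)) ⟩
  [ q zero ] + count (q ∘ suc)  ≡⟨ sym (count-suc q) ⟩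
  count q                       ∎
  where open ≡-Reasoning

count-punchIn : ∀ {n} (x : Fin (suc n)) (p : Fin (suc n) → Bool) →
                count p ≡ [ p x ] + count (p ∘ punchIn x)
count-punchIn zero p = count-suc p
count-punchIn {suc n} (suc x) p = begin
  count p                                                    ≡⟨ count-suc p ⟩
  [ p zero ] + count (p ∘ suc)                               ≡⟨ cong ([ p zero ] +_) (count-punchIn x (p ∘ suc)) ⟩
  [ p zero ] + ([ p (suc x) ] + count (p ∘ suc ∘ punchIn x)) ≡⟨ x∙yz≈y∙xz [ p zero ] [ p (suc x) ] _ ⟩
  [ p (suc x) ] + ([ p zero ] + count (p ∘ suc ∘ punchIn x)) ≡⟨ cong ([ p (suc x) ] +_) (sym (count-suc (p ∘ punchIn (suc x)))) ⟩
  [ p (suc x) ] + count (p ∘ punchIn (suc x))                ∎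
  where open ≡-Reasoning

count-reindex : ∀ {n} (p : Fin n → Bool) {h : Fin n → Fin n} → Injective _≡_ _≡_ h →
                count (p ∘ h) ≡ count p
count-reindex {zero} p h-inj = refl
count-reindex {suc n} p {h} h-inj = begin
  count (p ∘ h)                            ≡⟨ count-suc (p ∘ h) ⟩
  [ p x ] + count (p ∘ h ∘ suc)            ≡⟨ cong ([ p x ] +_) (count-ext (cong p ∘ sym ∘ punchIn-punchOut ∘ x≢h∘suc)) ⟩
  [ p x ] + count (p ∘ punchIn x ∘ h′)     ≡⟨ cong ([ p x ] +_) (count-reindex (p ∘ punchIn x) h′-inj) ⟩
  [ p x ] + count (p ∘ punchIn x)          ≡⟨ sym (count-punchIn x p) ⟩
  count p                                  ∎
  where
  open ≡-Reasoning
  x = h zero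
  x≢h∘suc : ∀ i → x ≢ h (suc i)
  x≢h∘suc i e with h-inj e
  ... | ()
  h′ : Fin n → Fin n
  h′ i = punchOut (x≢h∘suc i)
  h′-inj : Injective _≡_ _≡_ h′
  h′-inj e = suc-injective (h-inj (punchOut-injective (x≢h∘suc _) (x≢h∘suc _) e))

count-∨ : ∀ {n} (p q : Fin n → Bool) →
          count p + count q ≡ count (λ i → p i ∨ q i) + count (λ i → p i ∧ q i)
count-∨ {zero} p q = refl
count-∨ {suc n} p q
  rewrite count-suc p | count-suc q | count-suc (λ i → p i ∨ q i) | count-suc (λ i → p i ∧ q i)
  with p zero | q zero | count-∨ (p ∘ suc) (q ∘ suc)
... | true  | true  | ih = cong suc (trans (+-suc _ _) (trans (cong suc ih) (sym (+-suc _ _))))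
... | true  | false | ih = cong suc ih
... | false | true  | ih = trans (+-suc _ _) (cong suc ih)
... | false | false | ih = ih

count-false : ∀ {n} (p : Fin n → Bool) → (∀ i → p i ≡ false) → count p ≡ 0
count-false {zero} p p≡false = refl
count-false {suc n} p p≡false rewrite count-suc p | p≡false zero = count-false (p ∘ suc) (p≡false ∘ suc)

count-witness : ∀ {n} (p : Fin n → Bool) → 1 ≤ count p → ∃ λ a → T (p a)
count-witness {zero} p ()
count-witness {suc n} p 1≤count rewrite count-suc p with p zero in p0
... | true  = zero , Equivalence.from T-≡ p0
... | false with count-witness (p ∘ suc) 1≤count
...   | a , pa = suc a , pa

count-positive : ∀ {n} (p : Fin n → Bool) {a} → T (p a) → 1 ≤ count p
count-positive {suc n} p {a} pa rewrite count-punchIn a p | Equivalence.to T-≡ pa = s≤s z≤n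

count-two : ∀ {n} (p : Fin n → Bool) {a b} → T (p a) → T (p b) → a ≢ b → 2 ≤ count p
count-two {suc n} p {a} {b} pa pb a≢b rewrite count-punchIn a p | Equivalence.to T-≡ pa =
  s≤s (count-positive (p ∘ punchIn a) (subst (T ∘ p) (sym (punchIn-punchOut a≢b)) pb))

-- A cycle read as a sequence of vertices indexed by ℕ: positions 0 … suc (suc k) are
-- pairwise distinct, consecutive positions are adjacent, and position suc (suc (suc k))
-- is back at position 0.  Arithmetic on positions is easier than on Fin indices.
record ClosedSequence {n : ℕ} (G : Graph n) : Set where
  field
    k        : ℕ
    at       : ℕ → Fin n
    adjacent : ∀ i → i ≤ suc (suc k) → T (adj G (at i) (at (suc i)))
    returns  : at (suc (suc (suc k))) ≡ at 0
    distinct : ∀ {a b} → a ≤ suc (suc k) → b ≤ suc (suc k) → at a ≡ at b → a ≡ b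

module _ {n : ℕ} {G : Graph n} where

  sequence⇒cycle : ClosedSequence G → Cycle G
  sequence⇒cycle S = record { k = k ; vs = at ∘ toℕ ; inj = inj ; steps = steps ; close = close }
    where
    open ClosedSequence S
    position≤ : ∀ (ι : Fin (suc (suc (suc k)))) → toℕ ι ≤ suc (suc k)
    position≤ ι = ≤-pred (toℕ<n ι)
    inj : Injective _≡_ _≡_ (at ∘ toℕ)
    inj e = toℕ-injective (distinct (position≤ _) (position≤ _) e)
    steps : ∀ (ι : Fin (suc (suc k))) → T (adj G (at (toℕ (inject₁ ι))) (at (suc (toℕ ι))))
    steps ι rewrite toℕ-inject₁ ι = adjacent (toℕ ι) (<⇒≤ (toℕ<n ι))
    close : T (adj G (at (toℕ (fromℕ (suc (suc k))))) (at 0))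
    close rewrite toℕ-fromℕ (suc (suc k)) =
      subst (λ v → T (adj G (at (suc (suc k))) v)) returns (adjacent (suc (suc k)) ≤-refl)

  cycle⇒sequence : Cycle G → ClosedSequence G
  cycle⇒sequence C = record { k = k ; at = at ; adjacent = adjacent ; returns = returns ; distinct = distinct }
    where
    open Cycle C
    -- position i of the sequence, wrapping the single position past the end back to 0
    at : ℕ → Fin n
    at i with i <? suc (suc (suc k))
    ... | yes i<len = vs (fromℕ< i<len)
    ... | no _      = vs zero
    at-toℕ : ∀ ι → at (toℕ ι) ≡ vs ι
    at-toℕ ι with toℕ ι <? suc (suc (suc k))
    ... | yes ι<len = cong vs (fromℕ<-toℕ ι ι<len)
    ... | no ι≮len  = ⊥-elim (ι≮len (toℕ<n ι))
    at-position : ∀ {i} (ι : Fin (suc (suc (suc k)))) → toℕ ι ≡ i → at i ≡ vs ι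
    at-position ι refl = at-toℕ ι
    returns : at (suc (suc (suc k))) ≡ at 0
    returns with suc (suc (suc k)) <? suc (suc (suc k))
    ... | yes len<len = ⊥-elim (<-irrefl refl len<len)
    ... | no _        = refl
    adjacent : ∀ i → i ≤ suc (suc k) → T (adj G (at i) (at (suc i)))
    adjacent i i≤last with i <? suc (suc k)
    ... | yes i<last = subst T (sym (cong₂ (adj G) (at-position (inject₁ ι) i≡) (at-position (suc ι) si≡))) (steps ι)
      where
      ι = fromℕ< i<last
      i≡ : toℕ (inject₁ ι) ≡ i
      i≡ = trans (toℕ-inject₁ ι) (toℕ-fromℕ< i<last)
      si≡ : toℕ (suc ι) ≡ suc i
      si≡ = cong suc (toℕ-fromℕ< i<last)
    ... | no i≮last with ≤-antisym i≤last (≤-pred (≰⇒> i≮last))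
    ...   | refl =
      subst T (sym (cong₂ (adj G) (at-position (fromℕ i) (toℕ-fromℕ i)) (trans returns (at-toℕ zero)))) close
    distinct : ∀ {a b} → a ≤ suc (suc k) → b ≤ suc (suc k) → at a ≡ at b → a ≡ b
    distinct {a} {b} a≤last b≤last e = begin
      a            ≡⟨ sym (toℕ-fromℕ< a<len) ⟩
      toℕ (fromℕ< a<len) ≡⟨ cong toℕ (inj (trans (sym (at-fromℕ< a<len)) (trans e (at-fromℕ< b<len)))) ⟩
      toℕ (fromℕ< b<len) ≡⟨ toℕ-fromℕ< b<len ⟩
      b            ∎
      where
      open ≡-Reasoning
      a<len = s≤s a≤last
      b<len = s≤s b≤last
      at-fromℕ< : ∀ {i} (i<len : i < suc (suc (suc k))) → at i ≡ vs (fromℕ< i<len)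
      at-fromℕ< i<len = at-position (fromℕ< i<len) (toℕ-fromℕ< i<len)

forest-embedding : ∀ {m n} {G : Graph m} {H : Graph n} (h : Fin m → Fin n) →
                   Injective _≡_ _≡_ h → (∀ u v → T (adj G u v) → T (adj H (h u) (h v))) →
                   IsForest H → IsForest G
forest-embedding h h-inj h-adj forestH C = forestH record
  { k = k ; vs = h ∘ vs ; inj = inj ∘ h-inj
  ; steps = λ ι → h-adj _ _ (steps ι) ; close = h-adj _ _ close }
  where open Cycle C

false-unless-T : ∀ {b} → ¬ T b → b ≡ false
false-unless-T {false} _ = refl
false-unless-T {true} ¬t = ⊥-elim (¬t tt)

module _ {n : ℕ} {D : Digraph n} where

  walk-snoc : ∀ {u v w} → Walk⁺ D u v → T (arc D v w) → Walk⁺ D u w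
  walk-snoc (one uv) vw = step uv (one vw)
  walk-snoc (step uu′ u′v) vw = step uu′ (walk-snoc u′v vw)

  walk-first-arc : ∀ {u w} → Walk⁺ D u w → ∃ λ v → T (arc D u v)
  walk-first-arc (one uw) = _ , uw
  walk-first-arc (step uv _) = _ , uv

  walk-last-arc : ∀ {u w} → Walk⁺ D u w → ∃ λ v → T (arc D v w)
  walk-last-arc (one uw) = _ , uw
  walk-last-arc (step _ vw) = walk-last-arc vw

  walk-forwards : (g : ℕ → Fin n) → ∀ m → (∀ i → i ≤ m → T (arc D (g i) (g (suc i)))) →
                  Walk⁺ D (g 0) (g (suc m))
  walk-forwards g zero arcs = one (arcs 0 z≤n)
  walk-forwards g (suc m) arcs =
    walk-snoc (walk-forwards g m (λ i i≤m → arcs i (≤-trans i≤m (n≤1+n m)))) (arcs (suc m) ≤-refl)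

  walk-backwards : (g : ℕ → Fin n) → ∀ m → (∀ i → i ≤ m → T (arc D (g (suc i)) (g i))) →
                   Walk⁺ D (g (suc m)) (g 0)
  walk-backwards g zero arcs = one (arcs 0 z≤n)
  walk-backwards g (suc m) arcs =
    step (arcs (suc m) ≤-refl) (walk-backwards g m (λ i i≤m → arcs i (≤-trans i≤m (n≤1+n m))))

  in-neighbour-unique : (∀ v → indegree D v ≤ 1) → ∀ {a b z} → T (arc D a z) → T (arc D b z) → a ≡ b
  in-neighbour-unique in≤1 {a} {b} {z} az bz with a ≟ b
  ... | yes a≡b = a≡b
  ... | no a≢b with ≤-trans (count-two (λ u → arc D u z) az bz a≢b) (in≤1 z)
  ...   | s≤s ()

  phylogeny≡underlying : (∀ v → indegree D v ≤ 1) → ∀ u v → phylogenyAdj D u v ≡ underlyingAdj D u v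
  phylogeny≡underlying in≤1 u v = trans (cong (underlyingAdj D u v ∨_) no-competition) (∨-identityʳ _)
    where
    no-competition : competitionAdj D u v ≡ false
    no-competition with u ≟ v
    ... | yes _ = refl
    ... | no u≢v = false-unless-T λ common →
      let (w , uw∧vw) = satisfied (any⁻ (λ w → arc D u w ∧ arc D v w) (allFin n) common)
          (uw , vw) = Equivalence.to T-∧ uw∧vw
      in u≢v (in-neighbour-unique in≤1 uw vw)

underlying : ∀ {n} → Digraph n → Graph n
underlying D = record
  { adj = underlyingAdj D
  ; irrefl = λ u → cong₂ _∨_ (loopless D u) (loopless D u)
  ; symm = λ u v → ∨-comm (arc D u v) (arc D v u)
  }

module _ {n : ℕ} {D : Digraph n} (acyclic : Acyclic D) where

  no-2-cycle : ∀ u v → (arc D u v ∧ arc D v u) ≡ false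
  no-2-cycle u v = false-unless-T λ uv∧vu →
    let (uv , vu) = Equivalence.to T-∧ uv∧vu in acyclic u (step uv (one vu))

  -- in an acyclic digraph every edge of U(D) is a single arc, so degrees add up
  degree-underlying : ∀ v → degree (underlying D) v ≡ outdegree D v + indegree D v
  degree-underlying v = sym (begin
    outdegree D v + indegree D v
      ≡⟨ count-∨ (arc D v) (λ u → arc D u v) ⟩
    degree (underlying D) v + count (λ u → arc D v u ∧ arc D u v)
      ≡⟨ cong (degree (underlying D) v +_) (count-false _ (no-2-cycle v)) ⟩
    degree (underlying D) v + 0
      ≡⟨ +-identityʳ _ ⟩
    degree (underlying D) v ∎)
    where open ≡-Reasoning

  -- If every indegree is at most 1, U(D) has no cycle: along a cycle the arcs cannot
  -- change direction (the vertex where they meet would have two in-neighbours), so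
  -- they all point the same way and form a directed closed walk.
  underlying-forest : (∀ v → indegree D v ≤ 1) → IsForest (underlying D)
  underlying-forest in≤1 C = closed-walk
    where
    open ClosedSequence (cycle⇒sequence C)
    last : ℕ
    last = suc (suc k)
    Forward Backward : ℕ → Set
    Forward i = T (arc D (at i) (at (suc i)))
    Backward i = T (arc D (at (suc i)) (at i))
    direction : ∀ i → i ≤ last → Forward i ⊎ Backward i
    direction i i≤last = Equivalence.to T-∨ (adjacent i i≤last)
    unique : ∀ {a b z} → T (arc D a z) → T (arc D b z) → a ≡ b
    unique = in-neighbour-unique {D = D} in≤1
    no-meeting : ∀ i → i ≤ suc k → Forward i → Backward (suc i) → ⊥
    no-meeting i i≤sk fwd bwd with m≤n⇒m<n∨m≡n i≤sk
    ... | inj₁ i<sk = <⇒≢ (n≤1+n (suc i))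
                        (distinct (≤-trans i≤sk (n≤1+n _)) (s≤s i<sk) (unique fwd bwd))
    ... | inj₂ refl with distinct (n≤1+n _) z≤n (trans (unique fwd bwd) returns)
    ...   | ()
    no-meeting-at-start : Forward last → Backward 0 → ⊥
    no-meeting-at-start fwd bwd
      with distinct ≤-refl (s≤s z≤n) (unique (subst (λ v → T (arc D (at last) v)) returns fwd) bwd)
    ... | ()
    stays-forward : ∀ {i j} → Forward i → i ≤ j → j ≤ last → Forward j
    stays-forward {j = zero} fwd z≤n _ = fwd
    stays-forward {i} {suc j} fwd i≤sj sj≤last with m≤n⇒m<n∨m≡n i≤sj
    ... | inj₂ refl = fwd
    ... | inj₁ i<sj with direction (suc j) sj≤last
    ...   | inj₁ fwd′ = fwd′
    ...   | inj₂ bwd′ = ⊥-elim (no-meeting j (≤-pred sj≤last)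
                          (stays-forward fwd (≤-pred i<sj) (≤-trans (n≤1+n j) sj≤last)) bwd′)
    closed-walk : ⊥
    closed-walk with direction last ≤-refl
    ... | inj₁ fwd-last = acyclic (at 0) (subst (Walk⁺ D (at 0)) returns
                            (walk-forwards at last (λ i i≤last → stays-forward forward-start z≤n i≤last)))
      where
      forward-start : Forward 0
      forward-start with direction 0 z≤n
      ... | inj₁ fwd = fwd
      ... | inj₂ bwd = ⊥-elim (no-meeting-at-start fwd-last bwd)
    ... | inj₂ bwd-last = acyclic (at 0) (subst (λ v → Walk⁺ D v (at 0)) returns
                            (walk-backwards at last all-backward))
      where
      all-backward : ∀ i → i ≤ last → Backward i
      all-backward i i≤last with direction i i≤last
      ... | inj₂ bwd = bwd
      ... | inj₁ fwd = ⊥-elim (acyclic (at last) (step (stays-forward fwd i≤last ≤-refl) (one bwd-last)))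

  underlying-maxDegree : ∀ {j} → (∀ v → indegree D v ≤ 1) → (∀ v → outdegree D v ≤ j) →
                         MaxDegreeAtMost (underlying D) (suc j)
  underlying-maxDegree {j} in≤1 out≤j v = begin
    degree (underlying D) v        ≡⟨ degree-underlying v ⟩
    outdegree D v + indegree D v   ≤⟨ +-mono-≤ (out≤j v) (in≤1 v) ⟩
    j + 1                          ≡⟨ +-comm j 1 ⟩
    suc j                          ∎
    where open ≤-Reasoning

module _ {n : ℕ} {G H : Graph n} (π : Permutation′ n)
         (π-iso : ∀ u v → adj G (π ⟨$⟩ʳ u) (π ⟨$⟩ʳ v) ≡ adj H u v) where

  private
    π-injective : Injective _≡_ _≡_ (π ⟨$⟩ʳ_)
    π-injective e = trans (sym (inverseˡ π)) (trans (cong (π ⟨$⟩ˡ_) e) (inverseˡ π))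

    π⁻¹-injective : Injective _≡_ _≡_ (π ⟨$⟩ˡ_)
    π⁻¹-injective e = trans (sym (inverseʳ π)) (trans (cong (π ⟨$⟩ʳ_) e) (inverseʳ π))

    π⁻¹-iso : ∀ u v → adj H (π ⟨$⟩ˡ u) (π ⟨$⟩ˡ v) ≡ adj G u v
    π⁻¹-iso u v = trans (sym (π-iso _ _)) (cong₂ (adj G) (inverseʳ π) (inverseʳ π))

  forest-iso : IsForest H → IsForest G
  forest-iso = forest-embedding (π ⟨$⟩ˡ_) π⁻¹-injective
                 (λ u v → subst T (sym (π⁻¹-iso u v)))

  maxDegree-iso : ∀ {d} → MaxDegreeAtMost H d → MaxDegreeAtMost G d
  maxDegree-iso {d} H≤d v = subst (_≤ d) (sym degree≡) (H≤d (π ⟨$⟩ˡ v))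
    where
    degree≡ : degree G v ≡ degree H (π ⟨$⟩ˡ v)
    degree≡ = begin
      count (adj G v)                           ≡⟨ sym (count-reindex (adj G v) π-injective) ⟩
      count (λ u → adj G v (π ⟨$⟩ʳ u))           ≡⟨ count-ext (λ u → sym (π⁻¹-iso′ u)) ⟩
      count (adj H (π ⟨$⟩ˡ v))                   ∎
      where
      open ≡-Reasoning
      π⁻¹-iso′ : ∀ u → adj H (π ⟨$⟩ˡ v) u ≡ adj G v (π ⟨$⟩ʳ u)
      π⁻¹-iso′ u = trans (cong (adj H (π ⟨$⟩ˡ v)) (sym (inverseˡ π))) (π⁻¹-iso v (π ⟨$⟩ʳ u))

-- the "only if" direction: a (1,j) phylogeny graph is U(D) up to relabelling
phylogeny⇒forest : ∀ {n} j (G : Graph n) → IsPhylogenyGraph 1 j G →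
                   IsForest G × MaxDegreeAtMost G (suc j)
phylogeny⇒forest j G (D , (acyclic , in≤1 , out≤j) , π , G≅P) =
  forest-iso {H = underlying D} π G≅U (underlying-forest {D = D} acyclic in≤1) ,
  maxDegree-iso {G = G} {H = underlying D} π G≅U (underlying-maxDegree {D = D} acyclic in≤1 out≤j)
  where
  G≅U : ∀ u v → adj G (π ⟨$⟩ʳ u) (π ⟨$⟩ʳ v) ≡ underlyingAdj D u v
  G≅U u v = trans (G≅P u v) (phylogeny≡underlying {D = D} in≤1 u v)

-- In a graph on at least one vertex where every degree is at least 2 there is a cycle:
-- walk without ever returning along the edge just used; by pigeonhole some vertex
-- repeats, and the walk between the first repetition and its earlier occurrence is a
-- cycle (of length ≥ 3, as the walk neither stays put nor backtracks).
module MinDegreeTwo {N : ℕ} (G : Graph (suc N)) (degree≥2 : ∀ x → 2 ≤ degree G x) where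

  another-neighbour : ∀ prev cur → ∃ λ u → T (adj G cur u) × u ≢ prev
  another-neighbour prev cur with count-witness (adj G cur ∘ punchIn prev) others≥1
    where
    drop-one : ∀ b c → 2 ≤ [ b ] + c → 1 ≤ c
    drop-one true  c (s≤s 1≤c) = 1≤c
    drop-one false c 2≤c = ≤-trans (n≤1+n 1) 2≤c
    others≥1 : 1 ≤ count (adj G cur ∘ punchIn prev)
    others≥1 = drop-one _ _ (subst (2 ≤_) (count-punchIn prev (adj G cur)) (degree≥2 cur))
  ... | u , cur~u = punchIn prev u , cur~u , punchInᵢ≢i prev u

  edgeAt : ℕ → Fin (suc N) × Fin (suc N)
  edgeAt zero = zero , proj₁ (another-neighbour zero zero)
  edgeAt (suc i) = proj₂ (edgeAt i) , proj₁ (another-neighbour (proj₁ (edgeAt i)) (proj₂ (edgeAt i)))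

  walk : ℕ → Fin (suc N)
  walk i = proj₁ (edgeAt i)

  walk-adjacent : ∀ i → T (adj G (walk i) (walk (suc i)))
  walk-adjacent zero = proj₁ (proj₂ (another-neighbour zero zero))
  walk-adjacent (suc i) = proj₁ (proj₂ (another-neighbour (walk i) (walk (suc i))))

  walk-no-backtrack : ∀ i → walk (suc (suc i)) ≢ walk i
  walk-no-backtrack i = proj₂ (proj₂ (another-neighbour (walk i) (walk (suc i))))

  RepeatsAt : ℕ → Set
  RepeatsAt b = ∃ λ (a : Fin b) → walk (toℕ a) ≡ walk b

  -- the walk has more positions than G has vertices
  some-repeat : ∃ RepeatsAt
  some-repeat with pigeonhole (n<1+n (suc N)) (walk ∘ toℕ)
  ... | a , b , a<b , same = toℕ b , fromℕ< a<b , trans (cong walk (toℕ-fromℕ< a<b)) same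

  FirstRepeat : Set
  FirstRepeat = ∃ λ b → RepeatsAt b × (∀ {b′} → b′ < b → ¬ RepeatsAt b′)

  first-repeat : ∀ b → RepeatsAt b → FirstRepeat
  first-repeat = <-rec (λ b → RepeatsAt b → FirstRepeat) λ b earlier repeats →
    case any? (λ (c : Fin b) → repeats? (toℕ c)) of λ where
      (yes (c , repeats-c)) → earlier (toℕ<n c) repeats-c
      (no none) → b , repeats , λ b′<b repeats′ →
        none (fromℕ< b′<b , subst RepeatsAt (sym (toℕ-fromℕ< b′<b)) repeats′)
    where
    repeats? : ∀ b → Dec (RepeatsAt b)
    repeats? b = any? (λ a → walk (toℕ a) ≟ walk b)

  cycle : Cycle G
  cycle with first-repeat _ (proj₂ some-repeat)
  ... | b , (a , same) , first = sequence⇒cycle record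
    { k = k ; at = λ i → walk (i + toℕ a) ; adjacent = λ i _ → walk-adjacent (i + toℕ a)
    ; returns = trans (cong walk b≡) (sym same) ; distinct = distinct }
    where
    a<b : toℕ a < b
    a<b = toℕ<n a
    distinct-before : ∀ {x y} → x < b → y < b → walk x ≡ walk y → x ≡ y
    distinct-before {x} {y} x<b y<b e with <-cmp x y
    ... | tri≈ _ x≡y _ = x≡y
    ... | tri< x<y _ _ = ⊥-elim (first y<b (fromℕ< x<y , trans (cong walk (toℕ-fromℕ< x<y)) e))
    ... | tri> _ _ y<x = ⊥-elim (first x<b (fromℕ< y<x , trans (cong walk (toℕ-fromℕ< y<x)) (sym e)))
    b≢1+a : b ≢ suc (toℕ a)
    b≢1+a e = subst T (irrefl G (walk (toℕ a)))
                (subst (λ v → T (adj G (walk (toℕ a)) v)) (sym (trans same (cong walk e))) (walk-adjacent (toℕ a)))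
    b≢2+a : b ≢ suc (suc (toℕ a))
    b≢2+a e = walk-no-backtrack (toℕ a) (sym (trans same (cong walk e)))
    3+a≤b : suc (suc (suc (toℕ a))) ≤ b
    3+a≤b = ≤∧≢⇒< (≤∧≢⇒< a<b (b≢1+a ∘ sym)) (b≢2+a ∘ sym)
    k : ℕ
    k = proj₁ (m≤n⇒∃[o]m+o≡n 3+a≤b)
    b≡ : suc (suc (suc k)) + toℕ a ≡ b
    b≡ = trans (cong (λ m → suc (suc (suc m))) (+-comm k (toℕ a))) (proj₂ (m≤n⇒∃[o]m+o≡n 3+a≤b))
    distinct : ∀ {x y} → x ≤ suc (suc k) → y ≤ suc (suc k) → walk (x + toℕ a) ≡ walk (y + toℕ a) → x ≡ y
    distinct {x} {y} x≤ y≤ e = +-cancelʳ-≡ (toℕ a) x y (distinct-before (below x≤) (below y≤) e)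
      where
      below : ∀ {z} → z ≤ suc (suc k) → z + toℕ a < b
      below {z} z≤ = subst (z + toℕ a <_) b≡ (+-monoˡ-≤ (toℕ a) (s≤s z≤))

forest-has-leaf : ∀ {N} (G : Graph (suc N)) → IsForest G → ∃ λ x → degree G x ≤ 1
forest-has-leaf G forest with any? (λ x → degree G x ≤? 1)
... | yes leaf = leaf
... | no no-leaf = ⊥-elim (forest (MinDegreeTwo.cycle G λ x → ≰⇒> (λ x≤1 → no-leaf (x , x≤1))))

deleteVertex : ∀ {n} → Graph (suc n) → Fin (suc n) → Graph n
deleteVertex G x = record
  { adj = λ a b → adj G (punchIn x a) (punchIn x b)
  ; irrefl = λ a → irrefl G (punchIn x a)
  ; symm = λ a b → symm G (punchIn x a) (punchIn x b)
  }

degree-deleteVertex : ∀ {n} (G : Graph (suc n)) x a →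
                      degree G (punchIn x a) ≡ [ adj G (punchIn x a) x ] + degree (deleteVertex G x) a
degree-deleteVertex G x a = count-punchIn x (adj G (punchIn x a))

maxDegree-deleteVertex : ∀ {n d} (G : Graph (suc n)) x → MaxDegreeAtMost G d →
                         MaxDegreeAtMost (deleteVertex G x) d
maxDegree-deleteVertex {d = d} G x G≤d a =
  ≤-trans (m≤n+m _ _) (subst (_≤ d) (degree-deleteVertex G x a) (G≤d (punchIn x a)))

forest-deleteVertex : ∀ {n} (G : Graph (suc n)) x → IsForest G → IsForest (deleteVertex G x)
forest-deleteVertex G x = forest-embedding (punchIn x) (punchIn-injective x _ _) (λ _ _ t → t)

punchIn-view : ∀ {n} (x u : Fin (suc n)) → u ≡ x ⊎ ∃ λ a → u ≡ punchIn x a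
punchIn-view x u with x ≟ u
... | yes x≡u = inj₁ (sym x≡u)
... | no x≢u = inj₂ (punchOut x≢u , sym (punchIn-punchOut x≢u))

relabel : ∀ {n} (x u : Fin (suc n)) → Maybe (Fin n)
relabel x u with x ≟ u
... | yes _ = nothing
... | no x≢u = just (punchOut x≢u)

relabel-self : ∀ {n} (x : Fin (suc n)) → relabel x x ≡ nothing
relabel-self x with x ≟ x
... | yes _ = refl
... | no x≢x = ⊥-elim (x≢x refl)

relabel-punchIn : ∀ {n} (x : Fin (suc n)) a → relabel x (punchIn x a) ≡ just a
relabel-punchIn x a with x ≟ punchIn x a
... | yes x≡ = ⊥-elim (punchInᵢ≢i x a (sym x≡))
... | no x≢ = cong just (trans (punchOut-cong x refl) (punchOut-punchIn x))

-- Adding a vertex x to a digraph D′ on the other vertices: x receives an arc from a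
-- when inX a, and sends one to a when outX a.
module Extension {n : ℕ} (D′ : Digraph n) (x : Fin (suc n)) (inX outX : Fin n → Bool) where

  arcBetween : Maybe (Fin n) → Maybe (Fin n) → Bool
  arcBetween (just a) (just b) = arc D′ a b
  arcBetween nothing  (just b) = outX b
  arcBetween (just a) nothing  = inX a
  arcBetween nothing  nothing  = false

  D : Digraph (suc n)
  D = record
    { arc = λ u v → arcBetween (relabel x u) (relabel x v)
    ; loopless = λ u → no-loop (relabel x u)
    }
    where
    no-loop : ∀ m → arcBetween m m ≡ false
    no-loop (just a) = loopless D′ a
    no-loop nothing = refl

  arc-within : ∀ a b → arc D (punchIn x a) (punchIn x b) ≡ arc D′ a b
  arc-within a b rewrite relabel-punchIn x a | relabel-punchIn x b = refl

  arc-from-x : ∀ b → arc D x (punchIn x b) ≡ outX b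
  arc-from-x b rewrite relabel-self x | relabel-punchIn x b = refl

  arc-into-x : ∀ a → arc D (punchIn x a) x ≡ inX a
  arc-into-x a rewrite relabel-self x | relabel-punchIn x a = refl

  SourceOrSink : Set
  SourceOrSink = (∀ a → inX a ≡ false) ⊎ (∀ a → outX a ≡ false)

  no-transit : SourceOrSink → ∀ {u v w} → T (arc D u v) → T (arc D v w) → ∃ λ c → relabel x v ≡ just c
  no-transit mode {u} {v} {w} uv vw with relabel x v
  ... | just c = c , refl
  ... | nothing = ⊥-elim (blocked mode (relabel x u) (relabel x w) uv vw)
    where
    blocked : SourceOrSink → ∀ mu mw → T (arcBetween mu nothing) → T (arcBetween nothing mw) → ⊥
    blocked (inj₁ no-in)  (just a) _ t _ = subst T (no-in a) t
    blocked (inj₂ no-out) _ (just b) _ t = subst T (no-out b) t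

  avoid : SourceOrSink → ∀ {u w a b} → Walk⁺ D u w → relabel x u ≡ just a → relabel x w ≡ just b → Walk⁺ D′ a b
  avoid mode (one uw) ua wb = one (subst T (cong₂ arcBetween ua wb) uw)
  avoid mode (step uv vw) ua wb with no-transit mode uv (proj₂ (walk-first-arc vw))
  ... | c , vc = step (subst T (cong₂ arcBetween ua vc) uv) (avoid mode vw vc wb)

  -- so a directed closed walk of D can neither pass through x nor avoid it
  D-acyclic : SourceOrSink → Acyclic D′ → Acyclic D
  D-acyclic mode acyclic′ v closed with relabel x v in v↦
  ... | just a = acyclic′ a (avoid mode closed v↦ v↦)
  ... | nothing with no-transit mode (proj₂ (walk-last-arc closed)) (proj₂ (walk-first-arc closed))
  ...   | c , v↦c = case trans (sym v↦) v↦c of λ ()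

  indegree-x : indegree D x ≡ count inX
  indegree-x = trans (count-punchIn x (λ u → arc D u x))
                     (cong₂ _+_ (cong [_] (loopless D x)) (count-ext arc-into-x))

  outdegree-x : outdegree D x ≡ count outX
  outdegree-x = trans (count-punchIn x (arc D x))
                      (cong₂ _+_ (cong [_] (loopless D x)) (count-ext arc-from-x))

  indegree-other : ∀ a → indegree D (punchIn x a) ≡ [ outX a ] + indegree D′ a
  indegree-other a = trans (count-punchIn x (λ u → arc D u (punchIn x a)))
                           (cong₂ _+_ (cong [_] (arc-from-x a)) (count-ext (λ b → arc-within b a)))

  outdegree-other : ∀ a → outdegree D (punchIn x a) ≡ [ inX a ] + outdegree D′ a
  outdegree-other a = trans (count-punchIn x (arc D (punchIn x a)))
                            (cong₂ _+_ (cong [_] (arc-into-x a)) (count-ext (arc-within a)))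

  D-orients : ∀ (G : Graph (suc n)) →
            (∀ a b → underlyingAdj D′ a b ≡ adj (deleteVertex G x) a b) →
            (∀ a → (outX a ∨ inX a) ≡ adj G x (punchIn x a)) →
            ∀ u v → underlyingAdj D u v ≡ adj G u v
  D-orients G orients′ edges-at-x u v = by-cases (punchIn-view x u) (punchIn-view x v)
    where
    by-cases : u ≡ x ⊎ ∃ (λ a → u ≡ punchIn x a) → v ≡ x ⊎ ∃ (λ b → v ≡ punchIn x b) →
               underlyingAdj D u v ≡ adj G u v
    by-cases (inj₁ refl) (inj₁ refl) =
      trans (cong₂ _∨_ (loopless D x) (loopless D x)) (sym (irrefl G x))
    by-cases (inj₁ refl) (inj₂ (b , refl)) =
      trans (cong₂ _∨_ (arc-from-x b) (arc-into-x b)) (edges-at-x b)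
    by-cases (inj₂ (a , refl)) (inj₁ refl) =
      trans (cong₂ _∨_ (arc-into-x a) (arc-from-x a))
        (trans (∨-comm (inX a) (outX a)) (trans (edges-at-x a) (symm G x (punchIn x a))))
    by-cases (inj₂ (a , refl)) (inj₂ (b , refl)) =
      trans (cong₂ _∨_ (arc-within a b) (arc-within b a)) (orients′ a b)

record Orientation {n : ℕ} (j : ℕ) (G : Graph n) : Set where
  field
    digraph : Digraph n
    acyclic : Acyclic digraph
    in≤1    : ∀ v → indegree digraph v ≤ 1
    out≤j   : ∀ v → outdegree digraph v ≤ j
    orients : ∀ u v → underlyingAdj digraph u v ≡ adj G u v

  -- every edge at v is exactly one arc, into or out of v
  degree-split : ∀ v → degree G v ≡ outdegree digraph v + indegree digraph v
  degree-split v = trans (count-ext (λ u → sym (orients v u))) (degree-underlying acyclic v)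

-- If the neighbour of x has no
-- in-arc yet, x becomes a source pointing to it; otherwise x becomes a sink, and
-- the neighbour, having an in-arc and the edge to x, has at most j − 1 out-arcs so far.
module AttachLeaf {j n : ℕ} (1≤j : 1 ≤ j) (G : Graph (suc n)) (maxdeg : MaxDegreeAtMost G (suc j))
                  (x : Fin (suc n)) (leaf : degree G x ≤ 1) (O′ : Orientation j (deleteVertex G x)) where

  open Orientation O′ renaming (digraph to D′; acyclic to acyclic′; in≤1 to in′≤1; out≤j to out′≤j;
                                orients to orients′; degree-split to degree-split′)

  nbr : Fin n → Bool
  nbr a = adj G x (punchIn x a)

  -- x is not its own neighbour
  degree-x : degree G x ≡ count nbr
  degree-x = trans (count-punchIn x (adj G x)) (cong (_+ count nbr) (cong [_] (irrefl G x)))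

  nbr-unique : ∀ {a b} → T (nbr a) → T (nbr b) → a ≡ b
  nbr-unique {a} {b} xa xb with a ≟ b
  ... | yes a≡b = a≡b
  ... | no a≢b with ≤-trans (count-two nbr xa xb a≢b) (subst (_≤ 1) degree-x leaf)
  ...   | s≤s ()

  as-source : ∀ a₀ → T (nbr a₀) → indegree D′ a₀ ≡ 0 → Orientation j G
  as-source a₀ xa₀ a₀-unentered = record
    { digraph = D ; acyclic = D-acyclic (inj₁ λ _ → refl) acyclic′ ; in≤1 = in≤1 ; out≤j = out≤j
    ; orients = D-orients G orients′ (λ a → ∨-identityʳ (nbr a)) }
    where
    open Extension D′ x (λ _ → false) nbr
    in≤1 : ∀ v → indegree D v ≤ 1
    in≤1 v with punchIn-view x v
    ... | inj₁ refl = subst (_≤ 1) (sym (trans indegree-x (count-false {n} (λ _ → false) λ _ → refl))) z≤n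
    ... | inj₂ (a , refl) rewrite indegree-other a with nbr a in xa
    ...   | false = in′≤1 a
    ...   | true with nbr-unique (Equivalence.from T-≡ xa) xa₀
    ...     | refl = subst (λ d → suc d ≤ 1) (sym a₀-unentered) ≤-refl
    out≤j : ∀ v → outdegree D v ≤ j
    out≤j v with punchIn-view x v
    ... | inj₁ refl = subst (_≤ j) (sym (trans outdegree-x (sym degree-x))) (≤-trans leaf 1≤j)
    ... | inj₂ (a , refl) = subst (_≤ j) (sym (outdegree-other a)) (out′≤j a)

  as-sink : (∀ a → T (nbr a) → indegree D′ a ≢ 0) → Orientation j G
  as-sink entered = record
    { digraph = D ; acyclic = D-acyclic (inj₂ λ _ → refl) acyclic′ ; in≤1 = in≤1 ; out≤j = out≤j
    ; orients = D-orients G orients′ (λ a → refl) }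
    where
    open Extension D′ x nbr (λ _ → false)
    in≤1 : ∀ v → indegree D v ≤ 1
    in≤1 v with punchIn-view x v
    ... | inj₁ refl = subst (_≤ 1) (sym (trans indegree-x (sym degree-x))) leaf
    ... | inj₂ (a , refl) = subst (_≤ 1) (sym (indegree-other a)) (in′≤1 a)
    out≤j : ∀ v → outdegree D v ≤ j
    out≤j v with punchIn-view x v
    ... | inj₁ refl = subst (_≤ j) (sym (trans outdegree-x (count-false {n} (λ _ → false) λ _ → refl))) z≤n
    ... | inj₂ (a , refl) rewrite outdegree-other a with nbr a in xa
    ...   | false = out′≤j a
    ...   | true = begin
      suc (outdegree D′ a)                 ≡⟨ +-comm 1 _ ⟩
      outdegree D′ a + 1                   ≤⟨ +-monoʳ-≤ (outdegree D′ a) (n≢0⇒n>0 (entered a (Equivalence.from T-≡ xa))) ⟩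
      outdegree D′ a + indegree D′ a       ≡⟨ sym (degree-split′ a) ⟩
      degree (deleteVertex G x) a          ≤⟨ ≤-pred (subst (_≤ suc j) degree-a (maxdeg (punchIn x a))) ⟩
      j                                    ∎
      where
      open ≤-Reasoning
      degree-a : degree G (punchIn x a) ≡ suc (degree (deleteVertex G x) a)
      degree-a = trans (degree-deleteVertex G x a)
                       (cong (λ b → [ b ] + degree (deleteVertex G x) a) (trans (symm G _ x) xa))

  orientation : Orientation j G
  orientation with any? (λ a → T? (nbr a) ×-dec (indegree D′ a ≟ℕ 0))
  ... | yes (a₀ , xa₀ , unentered) = as-source a₀ xa₀ unentered
  ... | no no-source = as-sink (λ a xa unentered → no-source (a , xa , unentered))

orientation : ∀ {j} → 1 ≤ j → ∀ n (G : Graph n) → IsForest G → MaxDegreeAtMost G (suc j) → Orientation j G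
orientation 1≤j zero G _ _ = record
  { digraph = record { arc = λ () ; loopless = λ () }
  ; acyclic = λ () ; in≤1 = λ () ; out≤j = λ () ; orients = λ () }
orientation 1≤j (suc n) G forest maxdeg with forest-has-leaf G forest
... | x , leaf = AttachLeaf.orientation 1≤j G maxdeg x leaf
                   (orientation 1≤j n (deleteVertex G x) (forest-deleteVertex G x forest)
                     (maxDegree-deleteVertex G x maxdeg))

-- with indegrees ≤ 1 there is no competition, so an orientation makes G its own phylogeny graph
orientation⇒phylogeny : ∀ {n j} {G : Graph n} → Orientation j G → IsPhylogenyGraph 1 j G
orientation⇒phylogeny {G = G} O = digraph , (acyclic , in≤1 , out≤j) , Permutation.id , G≡P
  where
  open Orientation O
  G≡P : ∀ u v → adj G u v ≡ phylogenyAdj digraph u v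
  G≡P u v = sym (trans (phylogeny≡underlying {D = digraph} in≤1 u v) (orients u v))

theorem2p1 : (j : ℕ) → 1 ≤ j → (n : ℕ) → (G : Graph n) →
    IsPhylogenyGraph 1 j G ⇔ (IsForest G × MaxDegreeAtMost G (suc j))
theorem2p1 j 1≤j n G = mk⇔
  (phylogeny⇒forest j G)
  (λ (forest , maxdeg) → orientation⇒phylogeny (orientation 1≤j n G forest maxdeg))
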